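{- Let $\mathcal{C}$ be a clutter on a finite set $E$ that is minimally non-packing with respect to deletion. Then $\mathcal{C}$ is minimum-transversal-covered, i.e., every element of $E$ lies in some minimum transversal of $\mathcal{C}$.
   Context: A clutter on $E$ is a family of subsets none containing another (members: hyperedges). A transversal is an inclusion-minimal subset of $E$ meeting every hyperedge; a minimum transversal is one of minimum size $\mathrm{bn}(\mathcal{C})$. $\mathrm{pn}(\mathcal{C})$ is the maximum number of pairwise disjoint hyperedges; $\mathcal{C}$ packs if $\mathrm{pn}(\mathcal{C})=\mathrm{bn}(\mathcal{C})$. For $A\subseteq E$, $\mathcal{C}\setminus A=\{X\in\mathcal{C}:X\cap A=\emptyset\}$. $\mathcal{C}$ is minimally non-packing with respect to deletion if it does not pack but every proper deletion minor $\mathcal{C}\setminus A$ (with $A\neq\emptyset$) packs. -}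

module Defs where

open import Data.Nat using (ℕ; _≤_)
open import Data.Fin using (Fin)
open import Data.Fin.Subset using (Subset; _∈_; _⊆_; _⊂_; _∩_; ∣_∣; Nonempty; Empty)
open import Data.List using (List; length)
open import Data.List.Relation.Unary.All using (All)
open import Data.List.Relation.Unary.AllPairs using (AllPairs)
open import Data.Product using (Σ; _×_; ∃)
open import Relation.Binary.PropositionalEquality using (_≡_)
open import Relation.Nullary using (¬_)

Family : ℕ → Set₁
Family n = Subset n → Set

IsClutter : ∀ {n} → Family n → Set
IsClutter C = ∀ X Y → C X → C Y → X ⊆ Y → X ≡ Y

Cover : ∀ {n} → Family n → Subset n → Set
Cover C T = ∀ X → C X → Nonempty (T ∩ X)

Transversal : ∀ {n} → Family n → Subset n → Set
Transversal C T = Cover C T × (∀ T′ → T′ ⊂ T → ¬ Cover C T′)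

MinTransversal : ∀ {n} → Family n → Subset n → Set
MinTransversal C T = Transversal C T × (∀ T′ → Transversal C T′ → ∣ T ∣ ≤ ∣ T′ ∣)

Packing : ∀ {n} → Family n → List (Subset n) → Set
Packing C P = All C P × AllPairs (λ X Y → ¬ (X ≡ Y) × Empty (X ∩ Y)) P

-- pn(C) = bn(C): there is a packing whose size equals the size of a minimum
-- transversal (sizes of packings never exceed bn, so this packing is maximum).
Packs : ∀ {n} → Family n → Set
Packs C = Σ _ λ T → MinTransversal C T × Σ _ λ P → Packing C P × length P ≡ ∣ T ∣

_∖_ : ∀ {n} → Family n → Subset n → Family n
(C ∖ A) X = C X × Empty (X ∩ A)

MinNonPackingDel : ∀ {n} → Family n → Set
MinNonPackingDel C = ¬ Packs C × (∀ A → Nonempty A → Packs (C ∖ A))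

MinTransversalCovered : ∀ {n} → Family n → Set
MinTransversalCovered {n} C = ∀ (e : Fin n) → Σ _ λ T → MinTransversal C T × e ∈ T

{-# OPTIONS --safe #-}
-- Delete an element e. The minor C ∖ ⁅ e ⁆ packs: it has a minimum transversal T′ and
-- |T′| disjoint hyperedges, which also form a packing of C. Since C does not pack, every
-- cover of C has more than |T′| elements: a minimum cover of size at most |T′| would be a
-- minimum transversal matched by the first elements of that packing. On the other hand
-- T′ ∪ {e} covers C and has at most |T′| + 1 elements, so it is a cover of least size,
-- hence a minimum transversal containing e.
module Submission where

open import Defs
open import Data.Nat using (ℕ; zero; suc; _≤_; _<_; _+_; z≤n; s≤s)
open import Data.Nat.Properties
open import Data.Bool using (true; false)
open import Data.Vec using ([]; _∷_)
open import Data.Fin using (Fin)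
open import Data.Fin.Subset
open import Data.Fin.Subset.Properties
open import Data.List using (length; take)
open import Data.List.Properties using (length-take)
import Data.List.Relation.Unary.All as All
import Data.List.Relation.Unary.All.Properties as All
import Data.List.Relation.Unary.AllPairs.Properties as AllPairs
open import Data.Product
open import Data.Sum using (inj₁; inj₂)
open import Relation.Nullary
open import Relation.Unary using (Decidable)
open import Relation.Binary.PropositionalEquality

¬¬-decidable : ∀ {n} (P : Subset n → Set) → ¬ ¬ Decidable P
¬¬-decidable {zero} P ¬dec = ¬¬-excluded-middle λ P[]? → ¬dec λ { [] → P[]? }
¬¬-decidable {suc n} P ¬dec =
  ¬¬-decidable (λ X → P (true ∷ X)) λ P-in? →
  ¬¬-decidable (λ X → P (false ∷ X)) λ P-out? →
  ¬dec λ { (true ∷ X) → P-in? X ; (false ∷ X) → P-out? X }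

∣p∪q∣≤∣p∣+∣q∣ : ∀ {n} (p q : Subset n) → ∣ p ∪ q ∣ ≤ ∣ p ∣ + ∣ q ∣
∣p∪q∣≤∣p∣+∣q∣ [] [] = z≤n
∣p∪q∣≤∣p∣+∣q∣ (true ∷ p) (true ∷ q) = s≤s (≤-trans (∣p∪q∣≤∣p∣+∣q∣ p q) (+-monoʳ-≤ ∣ p ∣ (n≤1+n ∣ q ∣)))
∣p∪q∣≤∣p∣+∣q∣ (true ∷ p) (false ∷ q) = s≤s (∣p∪q∣≤∣p∣+∣q∣ p q)
∣p∪q∣≤∣p∣+∣q∣ (false ∷ p) (true ∷ q) = ≤-trans (s≤s (∣p∪q∣≤∣p∣+∣q∣ p q)) (≤-reflexive (sym (+-suc ∣ p ∣ ∣ q ∣)))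
∣p∪q∣≤∣p∣+∣q∣ (false ∷ p) (false ∷ q) = ∣p∪q∣≤∣p∣+∣q∣ p q

∣p∪⁅x⁆∣≤1+∣p∣ : ∀ {n} (p : Subset n) (x : Fin n) → ∣ p ∪ ⁅ x ⁆ ∣ ≤ suc ∣ p ∣
∣p∪⁅x⁆∣≤1+∣p∣ p x = begin
  ∣ p ∪ ⁅ x ⁆ ∣     ≤⟨ ∣p∪q∣≤∣p∣+∣q∣ p ⁅ x ⁆ ⟩
  ∣ p ∣ + ∣ ⁅ x ⁆ ∣ ≡⟨ cong (∣ p ∣ +_) (∣⁅x⁆∣≡1 x) ⟩
  ∣ p ∣ + 1         ≡⟨ +-comm ∣ p ∣ 1 ⟩
  suc ∣ p ∣         ∎
  where open ≤-Reasoning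

module _ {n : ℕ} (C : Family n) where

  MinimumCover : Subset n → Set
  MinimumCover M = Cover C M × (∀ S → Cover C S → ∣ M ∣ ≤ ∣ S ∣)

  minimumCover⇒minTransversal : ∀ {M} → MinimumCover M → MinTransversal C M
  minimumCover⇒minTransversal (cover , least) =
    (cover , λ S S⊂M coverS → <⇒≱ (p⊂q⇒∣p∣<∣q∣ S⊂M) (least S coverS)) ,
    λ T transversal → least T (proj₁ transversal)

  cover? : Decidable C → Decidable (Cover C)
  cover? C? S with anySubset? (λ X → C? X ×-dec ¬? (nonempty? (S ∩ X)))
  ... | yes (X , X∈C , missed) = no λ cover → missed (cover X X∈C)
  ... | no ¬missed = yes λ X X∈C → decidable-stable (nonempty? (S ∩ X)) λ missed → ¬missed (X , X∈C , missed)

  minimumCover-≤ : Decidable C → ∀ k S → Cover C S → ∣ S ∣ ≤ k → ∃ λ M → MinimumCover M × ∣ M ∣ ≤ ∣ S ∣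
  minimumCover-≤ C? zero S cover ∣S∣≤0 = S , (cover , λ _ _ → ≤-trans ∣S∣≤0 z≤n) , ≤-refl
  minimumCover-≤ C? (suc k) S cover ∣S∣≤1+k
    with anySubset? (λ S′ → cover? C? S′ ×-dec (suc ∣ S′ ∣ ≤? ∣ S ∣))
  ... | yes (S′ , cover′ , ∣S′∣<∣S∣) =
        let M , minimum , ∣M∣≤∣S′∣ = minimumCover-≤ C? k S′ cover′ (≤-pred (≤-trans ∣S′∣<∣S∣ ∣S∣≤1+k))
        in M , minimum , ≤-trans ∣M∣≤∣S′∣ (<⇒≤ ∣S′∣<∣S∣)
  ... | no ¬smaller = S , (cover , λ S′ cover′ → ≮⇒≥ λ ∣S′∣<∣S∣ → ¬smaller (S′ , cover′ , ∣S′∣<∣S∣)) , ≤-refl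

  packs-if-packing-≥-minimumCover : ∀ {M P} → MinimumCover M → Packing C P → ∣ M ∣ ≤ length P → Packs C
  packs-if-packing-≥-minimumCover {M} {P} minimum (P⊆C , disjoint) ∣M∣≤∣P∣ =
    M , minimumCover⇒minTransversal minimum ,
    take ∣ M ∣ P , (All.take⁺ (∣ M ∣) P⊆C , AllPairs.take⁺ (∣ M ∣) disjoint) ,
    trans (length-take ∣ M ∣ P) (m≤n⇒m⊓n≡m ∣M∣≤∣P∣)

  nonPacking⇒packing<cover : ¬ Packs C → ∀ {P S} → Packing C P → Cover C S → length P < ∣ S ∣
  nonPacking⇒packing<cover ¬packs {P} {S} packing cover = ≰⇒> λ ∣S∣≤∣P∣ →
    -- C need not be decidable, but the goal is now ⊥, so decidability may be assumed.
    ¬¬-decidable C λ C? →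
    let M , minimum , ∣M∣≤∣S∣ = minimumCover-≤ C? ∣ S ∣ S cover ≤-refl
    in ¬packs (packs-if-packing-≥-minimumCover minimum packing (≤-trans ∣M∣≤∣S∣ ∣S∣≤∣P∣))

  packing-∖ : ∀ {A P} → Packing (C ∖ A) P → Packing C P
  packing-∖ (P⊆C∖A , disjoint) = All.map proj₁ P⊆C∖A , disjoint

  cover-∖⁅x⁆ : ∀ {T x} → Cover (C ∖ ⁅ x ⁆) T → Cover C (T ∪ ⁅ x ⁆)
  cover-∖⁅x⁆ {T} {x} cover X X∈C with x ∈? X
  ... | yes x∈X = x , x∈p∩q⁺ (x∈p∪q⁺ (inj₂ (x∈⁅x⁆ x)) , x∈X)
  ... | no x∉X =
        let y , y∈T∩X = cover X (X∈C , X∩⁅x⁆-empty)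
            y∈T , y∈X = x∈p∩q⁻ T X y∈T∩X
        in y , x∈p∩q⁺ (x∈p∪q⁺ (inj₁ y∈T) , y∈X)
    where
    X∩⁅x⁆-empty : Empty (X ∩ ⁅ x ⁆)
    X∩⁅x⁆-empty (y , y∈X∩⁅x⁆) =
      let y∈X , y∈⁅x⁆ = x∈p∩q⁻ X ⁅ x ⁆ y∈X∩⁅x⁆
      in x∉X (subst (_∈ X) (x∈⁅y⁆⇒x≡y x y∈⁅x⁆) y∈X)

  nonPacking⇒minimumCover-∪⁅x⁆ : ¬ Packs C → ∀ {T P x} → Cover (C ∖ ⁅ x ⁆) T →
    Packing (C ∖ ⁅ x ⁆) P → length P ≡ ∣ T ∣ → MinimumCover (T ∪ ⁅ x ⁆)
  nonPacking⇒minimumCover-∪⁅x⁆ ¬packs {T} {P} {x} cover packing ∣P∣≡∣T∣ =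
    cover-∖⁅x⁆ cover , λ S coverS → begin
      ∣ T ∪ ⁅ x ⁆ ∣  ≤⟨ ∣p∪⁅x⁆∣≤1+∣p∣ T x ⟩
      suc ∣ T ∣      ≡⟨ cong suc (sym ∣P∣≡∣T∣) ⟩
      suc (length P) ≤⟨ nonPacking⇒packing<cover ¬packs (packing-∖ packing) coverS ⟩
      ∣ S ∣          ∎
    where open ≤-Reasoning

lemma2p1 : ∀ (n : ℕ) (C : Family n) → IsClutter C → MinNonPackingDel C → MinTransversalCovered C
lemma2p1 n C _ (¬packs , packs∖) e
  with packs∖ ⁅ e ⁆ (e , x∈⁅x⁆ e)
... | T , ((cover , _) , _) , P , packing , ∣P∣≡∣T∣ =
  T ∪ ⁅ e ⁆ ,
  minimumCover⇒minTransversal C (nonPacking⇒minimumCover-∪⁅x⁆ C ¬packs cover packing ∣P∣≡∣T∣) ,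
  x∈p∪q⁺ (inj₂ (x∈⁅x⁆ e))
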